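{- For non-negative integers $n,r$, $$(\mathbf{F}_{\mathbf{x}}-r-1)_n=n!\,\mathcal{P}_n(x;r)\qquad\text{and}\qquad(\mathbf{F}_{\mathbf{x}}+n+r)_n=n!\,\mathcal{T}_n(x;r),$$ where $\mathcal{P}_n(x;r)=\sum_{j=0}^n(-1)^j\binom{j+r}{r}x^{n-j}$ and $\mathcal{T}_n(x;r)=\sum_{j=0}^n\binom{n+r}{j+r}x^j$.
   Context: $(\alpha)_j=\alpha(\alpha-1)\cdots(\alpha-j+1)$ for $j\ge1$, $(\alpha)_0=1$. ${n\brace k}$ denotes the Stirling numbers of the second kind, and $\mathcal{F}_n(x)=\sum_{k=0}^n {n\brace k}k!\,x^k$ the Fubini polynomials. Umbral notation: for a polynomial $h(u)=\sum_k c_k u^k$ in an indeterminate $u$, $h(\mathbf{F}_{\mathbf{x}}):=\sum_k c_k\mathcal{F}_k(x)$ (linear map $u^k\mapsto\mathcal{F}_k(x)$); e.g. $(\mathbf{F}_{\mathbf{x}}-r-1)_n$ means the image of the polynomial $(u-r-1)_n$ under this map. -}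

module Defs where

open import Data.Nat as ℕ using (ℕ; zero; suc)
open import Data.Nat.Combinatorics using (_C_)
open import Data.Integer using (ℤ; +_; -_; _+_; _-_; _*_; _^_)
open import Data.List using (List; []; _∷_)

stirling2 : ℕ → ℕ → ℕ
stirling2 zero    zero    = 1
stirling2 zero    (suc k) = 0
stirling2 (suc n) zero    = 0
stirling2 (suc n) (suc k) = suc k ℕ.* stirling2 n (suc k) ℕ.+ stirling2 n k

factorial : ℕ → ℕ
factorial zero    = 1
factorial (suc n) = suc n ℕ.* factorial n

sumTo : ℕ → (ℕ → ℤ) → ℤ
sumTo zero    f = f 0
sumTo (suc n) f = sumTo n f + f (suc n)

fubini : ℤ → ℕ → ℤ
fubini x n = sumTo n (λ k → + (stirling2 n k ℕ.* factorial k) * x ^ k)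

-- Polynomials in the indeterminate u with integer coefficients,
-- as coefficient lists in ascending degree (c₀ ∷ c₁ ∷ ...).
Poly : Set
Poly = List ℤ

addP : Poly → Poly → Poly
addP []       q        = q
addP (a ∷ p)  []       = a ∷ p
addP (a ∷ p)  (b ∷ q)  = (a + b) ∷ addP p q

scaleP : ℤ → Poly → Poly
scaleP c []      = []
scaleP c (a ∷ p) = (c * a) ∷ scaleP c p

mulLin : ℤ → Poly → Poly
mulLin a p = addP (+ 0 ∷ p) (scaleP a p)

-- falling factorial (u + c)_n = (u+c)(u+c-1)...(u+c-n+1), as a polynomial in u
fallingPoly : ℤ → ℕ → Poly
fallingPoly c zero    = + 1 ∷ []
fallingPoly c (suc n) = mulLin (c - + n) (fallingPoly c n)

umbralFrom : (ℕ → ℤ) → ℕ → Poly → ℤ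
umbralFrom F k []       = + 0
umbralFrom F k (c ∷ cs) = c * F k + umbralFrom F (suc k) cs

-- h(F_x) : the linear map u^k ↦ F_k(x)
umbral : ℤ → Poly → ℤ
umbral x h = umbralFrom (fubini x) 0 h

Pfun : ℕ → ℤ → ℕ → ℤ
Pfun n x r = sumTo n (λ j → (- + 1) ^ j * + ((j ℕ.+ r) C r) * x ^ (n ℕ.∸ j))

Tfun : ℕ → ℤ → ℕ → ℤ
Tfun n x r = sumTo n (λ j → + ((n ℕ.+ r) C (j ℕ.+ r)) * x ^ j)

module Submission where

-- Encode a weight sequence w : ℕ → ℤ by its Stirling transform
-- Sw(i) = Σₖ {i brace k} wₖ; for the weights gₖ = k! xᵏ this is the Fubini
-- sequence.  The Stirling recurrence gives Sw(i+1) = S(∂w)(i) with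
-- (∂w)ₖ = k wₖ + wₖ₊₁, so evaluating a product (u + a)·p umbrally against Sw
-- equals evaluating p against S(∂w) plus a times evaluating p against Sw.
-- Hence the umbral value V(w,c,n) of the falling factorial (u + c)ₙ obeys
-- V(w,c,n+1) = V(∂w,c,n) + (c - n) V(w,c,n), a recurrence linear in w.
-- Thinking of w as an exponential generating function W(t), ∂ is (1+t)d/dt;
-- with t·W (weights k w_{k-1}) one gets V(tW,c,n+1) = (n+1) V(W,c,n), and the
-- constant weight 1 gives V = (c)ₙ.  Since g = x·(t g) + 1, the values
-- aₙ = (F_x + c)ₙ satisfy a_{n+1} = x(n+1)aₙ + (c)_{n+1}.  Both identities then
-- follow by induction on n from the matching recurrences of P and T, using
-- (-r-1)ₙ = (-1)ⁿ n! C(n+r,r) and (n+r)ₙ = n! C(n+r,r).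

open import Defs
open import Data.Nat using (ℕ)
open import Data.Integer using (ℤ; +_; -_; _+_; _-_; _*_)
open import Data.Product using (_×_)
open import Relation.Binary.PropositionalEquality using (_≡_)

open import Data.Nat as ℕ using (zero; suc; _≤_; _<_; z≤n; s≤s; _!)
import Data.Nat.Properties as ℕP
open import Data.Nat.DivMod using (m/n*n≡m)
open import Data.Nat.Combinatorics using (_C_; nCn≡1; k![n∸k]!∣n!; nCk≡n!/k![n-k]!)
import Data.Nat.Tactic.RingSolver as ℕSolver
open import Data.Integer using (_^_)
import Data.Integer.Properties as ℤP
open import Data.Integer.Tactic.RingSolver using (solve-∀)
open import Data.List using ([]; _∷_)
open import Data.Product using (_,_)
open import Function using (_∘_)
open import Relation.Binary.PropositionalEquality
  using (refl; sym; trans; cong; cong₂; module ≡-Reasoning)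

open ≡-Reasoning

sumTo-cong : ∀ n {f g : ℕ → ℤ} → (∀ j → j ≤ n → f j ≡ g j) → sumTo n f ≡ sumTo n g
sumTo-cong zero    f≗g = f≗g 0 z≤n
sumTo-cong (suc n) f≗g =
  cong₂ _+_ (sumTo-cong n (λ j j≤n → f≗g j (ℕP.m≤n⇒m≤1+n j≤n))) (f≗g (suc n) ℕP.≤-refl)

sumTo-+ : ∀ n (f g : ℕ → ℤ) → sumTo n (λ j → f j + g j) ≡ sumTo n f + sumTo n g
sumTo-+ zero    f g = refl
sumTo-+ (suc n) f g = trans (cong (_+ (f (suc n) + g (suc n))) (sumTo-+ n f g))
                            (interchange (sumTo n f) (sumTo n g) (f (suc n)) (g (suc n)))
  where
  interchange : ∀ a b c d → (a + b) + (c + d) ≡ (a + c) + (b + d)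
  interchange = solve-∀

sumTo-*ˡ : ∀ n (a : ℤ) (f : ℕ → ℤ) → a * sumTo n f ≡ sumTo n (λ j → a * f j)
sumTo-*ˡ zero    a f = refl
sumTo-*ˡ (suc n) a f = trans (ℤP.*-distribˡ-+ a (sumTo n f) (f (suc n)))
                             (cong (_+ (a * f (suc n))) (sumTo-*ˡ n a f))

sumTo-suc : ∀ n (f : ℕ → ℤ) → sumTo (suc n) f ≡ f 0 + sumTo n (f ∘ suc)
sumTo-suc zero    f = refl
sumTo-suc (suc n) f = trans (cong (_+ f (suc (suc n))) (sumTo-suc n f))
                            (ℤP.+-assoc (f 0) (sumTo n (f ∘ suc)) (f (suc (suc n))))

sumTo-reindex : ∀ n (f : ℕ → ℤ) → f 0 ≡ + 0 → f (suc n) ≡ + 0 → sumTo n (f ∘ suc) ≡ sumTo n f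
sumTo-reindex n f f0≡0 fn≡0 = begin
  sumTo n (f ∘ suc)             ≡⟨ ℤP.+-identityˡ (sumTo n (f ∘ suc)) ⟨
  + 0 + sumTo n (f ∘ suc)       ≡⟨ cong (_+ sumTo n (f ∘ suc)) f0≡0 ⟨
  f 0 + sumTo n (f ∘ suc)       ≡⟨ sumTo-suc n f ⟨
  sumTo n f + f (suc n)         ≡⟨ cong (λ z → sumTo n f + z) fn≡0 ⟩
  sumTo n f + + 0               ≡⟨ ℤP.+-identityʳ (sumTo n f) ⟩
  sumTo n f                     ∎

-- Stirling numbers and the Stirling transform

stirling2-above : ∀ {i j} → i < j → stirling2 i j ≡ 0
stirling2-above {zero}  {suc j} _         = refl
stirling2-above {suc i} {suc j} (s≤s i<j) =
  trans (cong₂ (λ a b → suc j ℕ.* a ℕ.+ b) (stirling2-above (ℕP.m<n⇒m<1+n i<j)) (stirling2-above i<j))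
        (cong (ℕ._+ 0) (ℕP.*-zeroʳ (suc j)))

stirlingTransform : (ℕ → ℤ) → ℕ → ℤ
stirlingTransform w i = sumTo i (λ k → + stirling2 i k * w k)

-- The operator on weights realising the index shift of the transform; on
-- exponential generating functions it is (1 + t) d/dt.
∂ : (ℕ → ℤ) → ℕ → ℤ
∂ w k = + k * w k + w (suc k)

-- The shift law, from {i+1 brace k+1} = (k+1){i brace k+1} + {i brace k}; the
-- k-weighted part may be reindexed because its terms k = 0 and k = i+1 vanish.
stirlingTransform-suc : ∀ w i → stirlingTransform w (suc i) ≡ stirlingTransform (∂ w) i
stirlingTransform-suc w i = begin
  stirlingTransform w (suc i)
    ≡⟨ sumTo-suc i (λ k → + stirling2 (suc i) k * w k) ⟩
  + 0 + sumTo i (λ k → + stirling2 (suc i) (suc k) * w (suc k))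
    ≡⟨ ℤP.+-identityˡ _ ⟩
  sumTo i (λ k → + stirling2 (suc i) (suc k) * w (suc k))
    ≡⟨ sumTo-cong i (λ k _ → pascal k) ⟩
  sumTo i (λ k → g (suc k) + h k)
    ≡⟨ sumTo-+ i (g ∘ suc) h ⟩
  sumTo i (g ∘ suc) + sumTo i h
    ≡⟨ cong (_+ sumTo i h) (sumTo-reindex i g refl g-top) ⟩
  sumTo i g + sumTo i h
    ≡⟨ sumTo-+ i g h ⟨
  sumTo i (λ k → g k + h k)
    ≡⟨ sumTo-cong i (λ k _ → collect (+ k) (+ stirling2 i k) (w k) (w (suc k))) ⟩
  stirlingTransform (∂ w) i
    ∎
  where
  g h : ℕ → ℤ
  g k = + k * (+ stirling2 i k * w k)
  h k = + stirling2 i k * w (suc k)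

  g-top : g (suc i) ≡ + 0
  g-top = begin
    + suc i * (+ stirling2 i (suc i) * w (suc i))
      ≡⟨ cong (λ s → + suc i * (+ s * w (suc i))) (stirling2-above (ℕP.n<1+n i)) ⟩
    + suc i * + 0
      ≡⟨ ℤP.*-zeroʳ (+ suc i) ⟩
    + 0
      ∎

  distribute : ∀ m a b y → (m * a + b) * y ≡ m * (a * y) + b * y
  distribute = solve-∀

  pascal : ∀ k → + stirling2 (suc i) (suc k) * w (suc k) ≡ g (suc k) + h k
  pascal k = begin
    + (suc k ℕ.* stirling2 i (suc k) ℕ.+ stirling2 i k) * w (suc k)
      ≡⟨ cong (_* w (suc k)) (trans (ℤP.pos-+ _ (stirling2 i k))
                                    (cong (_+ + stirling2 i k) (ℤP.pos-* (suc k) (stirling2 i (suc k))))) ⟩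
    (+ suc k * + stirling2 i (suc k) + + stirling2 i k) * w (suc k)
      ≡⟨ distribute (+ suc k) (+ stirling2 i (suc k)) (+ stirling2 i k) (w (suc k)) ⟩
    g (suc k) + h k
      ∎

  collect : ∀ k s a b → k * (s * a) + s * b ≡ s * (k * a + b)
  collect = solve-∀

-- Umbral evaluation against an arbitrary moment sequence F (uᵏ ↦ F k)

umbralFrom-cong : ∀ {F G : ℕ → ℤ} → (∀ i → F i ≡ G i) →
                  ∀ k p → umbralFrom F k p ≡ umbralFrom G k p
umbralFrom-cong F≗G k []      = refl
umbralFrom-cong F≗G k (c ∷ p) = cong₂ _+_ (cong (c *_) (F≗G k)) (umbralFrom-cong F≗G (suc k) p)

umbralFrom-suc : ∀ F k p → umbralFrom F (suc k) p ≡ umbralFrom (F ∘ suc) k p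
umbralFrom-suc F k []      = refl
umbralFrom-suc F k (c ∷ p) = cong (λ z → c * F (suc k) + z) (umbralFrom-suc F (suc k) p)

umbralFrom-addP : ∀ F k p q → umbralFrom F k (addP p q) ≡ umbralFrom F k p + umbralFrom F k q
umbralFrom-addP F k []      q       = sym (ℤP.+-identityˡ _)
umbralFrom-addP F k (a ∷ p) []      = sym (ℤP.+-identityʳ _)
umbralFrom-addP F k (a ∷ p) (b ∷ q) =
  trans (cong (λ z → (a + b) * F k + z) (umbralFrom-addP F (suc k) p q))
        (regroup a b (F k) (umbralFrom F (suc k) p) (umbralFrom F (suc k) q))
  where
  regroup : ∀ a b f s t → (a + b) * f + (s + t) ≡ (a * f + s) + (b * f + t)
  regroup = solve-∀

umbralFrom-scaleP : ∀ F k a p → umbralFrom F k (scaleP a p) ≡ a * umbralFrom F k p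
umbralFrom-scaleP F k a []      = sym (ℤP.*-zeroʳ a)
umbralFrom-scaleP F k a (c ∷ p) =
  trans (cong (λ z → (a * c) * F k + z) (umbralFrom-scaleP F (suc k) a p))
        (factor a c (F k) (umbralFrom F (suc k) p))
  where
  factor : ∀ a c f s → (a * c) * f + a * s ≡ a * (c * f + s)
  factor = solve-∀

umbral-mulLin : ∀ F a p → umbralFrom F 0 (mulLin a p) ≡ umbralFrom (F ∘ suc) 0 p + a * umbralFrom F 0 p
umbral-mulLin F a p = begin
  umbralFrom F 0 (addP (+ 0 ∷ p) (scaleP a p))
    ≡⟨ umbralFrom-addP F 0 (+ 0 ∷ p) (scaleP a p) ⟩
  (+ 0 + umbralFrom F 1 p) + umbralFrom F 0 (scaleP a p)
    ≡⟨ cong₂ _+_ (ℤP.+-identityˡ (umbralFrom F 1 p)) (umbralFrom-scaleP F 0 a p) ⟩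
  umbralFrom F 1 p + a * umbralFrom F 0 p
    ≡⟨ cong (_+ a * umbralFrom F 0 p) (umbralFrom-suc F 0 p) ⟩
  umbralFrom (F ∘ suc) 0 p + a * umbralFrom F 0 p
    ∎

-- The umbral value of the falling factorial (u + c)ₙ against the transform of w,
-- defined by the recurrence that umbral-mulLin and stirlingTransform-suc force.
fallingValue : (ℕ → ℤ) → ℤ → ℕ → ℤ
fallingValue w c zero    = w 0
fallingValue w c (suc n) = fallingValue (∂ w) c n + (c - + n) * fallingValue w c n

umbral-fallingPoly : ∀ w c n → umbralFrom (stirlingTransform w) 0 (fallingPoly c n) ≡ fallingValue w c n
umbral-fallingPoly w c zero    =
  trans (ℤP.+-identityʳ _) (trans (ℤP.*-identityˡ _) (ℤP.*-identityˡ (w 0)))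
umbral-fallingPoly w c (suc n) = begin
  umbralFrom (stirlingTransform w) 0 (mulLin (c - + n) (fallingPoly c n))
    ≡⟨ umbral-mulLin (stirlingTransform w) (c - + n) (fallingPoly c n) ⟩
  umbralFrom (stirlingTransform w ∘ suc) 0 (fallingPoly c n)
    + (c - + n) * umbralFrom (stirlingTransform w) 0 (fallingPoly c n)
    ≡⟨ cong₂ (λ a b → a + (c - + n) * b)
             (trans (umbralFrom-cong (stirlingTransform-suc w) 0 (fallingPoly c n))
                    (umbral-fallingPoly (∂ w) c n))
             (umbral-fallingPoly w c n) ⟩
  fallingValue (∂ w) c n + (c - + n) * fallingValue w c n
    ∎

fallingValue-cong : ∀ {w v} → (∀ k → w k ≡ v k) → ∀ c n → fallingValue w c n ≡ fallingValue v c n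
fallingValue-cong w≗v c zero    = w≗v 0
fallingValue-cong w≗v c (suc n) =
  cong₂ _+_ (fallingValue-cong (λ k → cong₂ _+_ (cong (+ k *_) (w≗v k)) (w≗v (suc k))) c n)
            (cong ((c - + n) *_) (fallingValue-cong w≗v c n))

fallingValue-+ : ∀ w v c n → fallingValue (λ k → w k + v k) c n ≡ fallingValue w c n + fallingValue v c n
fallingValue-+ w v c zero    = refl
fallingValue-+ w v c (suc n) = begin
  fallingValue (∂ (λ k → w k + v k)) c n + (c - + n) * fallingValue (λ k → w k + v k) c n
    ≡⟨ cong₂ (λ a b → a + (c - + n) * b)
             (trans (fallingValue-cong (λ k → ∂-+ (+ k) (w k) (v k) (w (suc k)) (v (suc k))) c n)
                    (fallingValue-+ (∂ w) (∂ v) c n))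
             (fallingValue-+ w v c n) ⟩
  (fallingValue (∂ w) c n + fallingValue (∂ v) c n) + (c - + n) * (fallingValue w c n + fallingValue v c n)
    ≡⟨ regroup (fallingValue (∂ w) c n) (fallingValue (∂ v) c n) (c - + n)
               (fallingValue w c n) (fallingValue v c n) ⟩
  fallingValue w c (suc n) + fallingValue v c (suc n)
    ∎
  where
  ∂-+ : ∀ k a b a′ b′ → k * (a + b) + (a′ + b′) ≡ (k * a + a′) + (k * b + b′)
  ∂-+ = solve-∀
  regroup : ∀ a b m c d → (a + b) + m * (c + d) ≡ (a + m * c) + (b + m * d)
  regroup = solve-∀

fallingValue-* : ∀ a w c n → fallingValue (λ k → a * w k) c n ≡ a * fallingValue w c n
fallingValue-* a w c zero    = refl
fallingValue-* a w c (suc n) = begin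
  fallingValue (∂ (λ k → a * w k)) c n + (c - + n) * fallingValue (λ k → a * w k) c n
    ≡⟨ cong₂ (λ s t → s + (c - + n) * t)
             (trans (fallingValue-cong (λ k → ∂-* (+ k) a (w k) (w (suc k))) c n)
                    (fallingValue-* a (∂ w) c n))
             (fallingValue-* a w c n) ⟩
  a * fallingValue (∂ w) c n + (c - + n) * (a * fallingValue w c n)
    ≡⟨ factor a (fallingValue (∂ w) c n) (c - + n) (fallingValue w c n) ⟩
  a * fallingValue w c (suc n)
    ∎
  where
  ∂-* : ∀ k a b b′ → k * (a * b) + a * b′ ≡ a * (k * b + b′)
  ∂-* = solve-∀
  factor : ∀ a s m t → a * s + m * (a * t) ≡ a * (s + m * t)
  factor = solve-∀

-- Three special weight sequences, named after their exponential generating functions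

-- Multiplication by t: weights k w_{k-1}.
timesT : (ℕ → ℤ) → ℕ → ℤ
timesT w zero    = + 0
timesT w (suc k) = + suc k * w k

-- The constant 1: weights δ_{k0}.
one : ℕ → ℤ
one zero    = + 1
one (suc k) = + 0

-- 1/(1 - x t): weights k! xᵏ, whose Stirling transform is the Fubini sequence.
geometric : ℤ → ℕ → ℤ
geometric x k = + factorial k * x ^ k

-- Product rule for (1+t)d/dt: ∂(tW) = t ∂W + tW + W.
∂-timesT : ∀ w k → ∂ (timesT w) k ≡ timesT (∂ w) k + (timesT w k + w k)
∂-timesT w zero    = base (w 0)
  where
  base : ∀ y → + 0 * + 0 + + 1 * y ≡ + 0 + (+ 0 + y)
  base = solve-∀
∂-timesT w (suc m) = step (+ m) (w m) (w (suc m))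
  where
  step : ∀ m a b → (+ 1 + m) * ((+ 1 + m) * a) + (+ 1 + (+ 1 + m)) * b
                 ≡ (+ 1 + m) * (m * a + b) + ((+ 1 + m) * a + b)
  step = solve-∀

fallingValue-timesT : ∀ w c n → fallingValue (timesT w) c (suc n) ≡ + suc n * fallingValue w c n
fallingValue-timesT w c zero    = base (w 0) c
  where
  base : ∀ y c → (+ 0 * + 0 + + 1 * y) + (c - + 0) * + 0 ≡ + 1 * y
  base = solve-∀
fallingValue-timesT w c (suc n) = begin
  fallingValue (∂ (timesT w)) c (suc n) + (c - + suc n) * fallingValue (timesT w) c (suc n)
    ≡⟨ cong₂ (λ s t → s + (c - + suc n) * t) expand (fallingValue-timesT w c n) ⟩
  (+ suc n * A + (+ suc n * B + (A + (c - + n) * B))) + (c - + suc n) * (+ suc n * B)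
    ≡⟨ collect A B c (+ n) ⟩
  + suc (suc n) * fallingValue w c (suc n)
    ∎
  where
  A = fallingValue (∂ w) c n
  B = fallingValue w c n

  expand : fallingValue (∂ (timesT w)) c (suc n) ≡ + suc n * A + (+ suc n * B + fallingValue w c (suc n))
  expand = begin
    fallingValue (∂ (timesT w)) c (suc n)
      ≡⟨ fallingValue-cong (∂-timesT w) c (suc n) ⟩
    fallingValue (λ k → timesT (∂ w) k + (timesT w k + w k)) c (suc n)
      ≡⟨ fallingValue-+ (timesT (∂ w)) (λ k → timesT w k + w k) c (suc n) ⟩
    fallingValue (timesT (∂ w)) c (suc n) + fallingValue (λ k → timesT w k + w k) c (suc n)
      ≡⟨ cong₂ _+_ (fallingValue-timesT (∂ w) c n) (fallingValue-+ (timesT w) w c (suc n)) ⟩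
    + suc n * A + (fallingValue (timesT w) c (suc n) + fallingValue w c (suc n))
      ≡⟨ cong (λ t → + suc n * A + (t + fallingValue w c (suc n))) (fallingValue-timesT w c n) ⟩
    + suc n * A + (+ suc n * B + fallingValue w c (suc n))
      ∎

  collect : ∀ A B c n →
    ((+ 1 + n) * A + ((+ 1 + n) * B + (A + (c - n) * B))) + (c - (+ 1 + n)) * ((+ 1 + n) * B)
      ≡ (+ 1 + (+ 1 + n)) * (A + (c - n) * B)
  collect = solve-∀

fallingℤ : ℤ → ℕ → ℤ
fallingℤ c zero    = + 1
fallingℤ c (suc n) = (c - + n) * fallingℤ c n

fallingValue-one : ∀ c n → fallingValue one c n ≡ fallingℤ c n
fallingValue-one c zero    = refl
fallingValue-one c (suc n) = begin
  fallingValue (∂ one) c n + (c - + n) * fallingValue one c n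
    ≡⟨ cong₂ (λ s t → s + (c - + n) * t) (fallingValue-cong ∂-one c n) (fallingValue-one c n) ⟩
  fallingValue (λ _ → + 0 * + 0) c n + (c - + n) * fallingℤ c n
    ≡⟨ cong (_+ (c - + n) * fallingℤ c n) (fallingValue-* (+ 0) (λ _ → + 0) c n) ⟩
  + 0 + (c - + n) * fallingℤ c n
    ≡⟨ ℤP.+-identityˡ _ ⟩
  fallingℤ c (suc n)
    ∎
  where
  ∂-one : ∀ k → ∂ one k ≡ + 0 * + 0
  ∂-one zero    = refl
  ∂-one (suc k) = trans (ℤP.+-identityʳ _) (ℤP.*-zeroʳ (+ suc k))

-- 1/(1 - x t) = x t · 1/(1 - x t) + 1.
geometric-split : ∀ x k → x * timesT (geometric x) k + one k ≡ geometric x k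
geometric-split x zero    = base x
  where
  base : ∀ x → x * + 0 + + 1 ≡ + 1 * + 1
  base = solve-∀
geometric-split x (suc m) = begin
  x * (+ suc m * (+ factorial m * x ^ m)) + + 0
    ≡⟨ shuffle x (+ suc m) (+ factorial m) (x ^ m) ⟩
  (+ suc m * + factorial m) * (x * x ^ m)
    ≡⟨ cong (_* x ^ suc m) (ℤP.pos-* (suc m) (factorial m)) ⟨
  geometric x (suc m)
    ∎
  where
  shuffle : ∀ x m f y → x * (m * (f * y)) + + 0 ≡ (m * f) * (x * y)
  shuffle = solve-∀

fallingValue-geometric : ∀ x c n →
  fallingValue (geometric x) c (suc n) ≡ x * (+ suc n * fallingValue (geometric x) c n) + fallingℤ c (suc n)
fallingValue-geometric x c n = begin
  fallingValue (geometric x) c (suc n)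
    ≡⟨ fallingValue-cong (geometric-split x) c (suc n) ⟨
  fallingValue (λ k → x * timesT (geometric x) k + one k) c (suc n)
    ≡⟨ fallingValue-+ (λ k → x * timesT (geometric x) k) one c (suc n) ⟩
  fallingValue (λ k → x * timesT (geometric x) k) c (suc n) + fallingValue one c (suc n)
    ≡⟨ cong₂ _+_ (trans (fallingValue-* x (timesT (geometric x)) c (suc n))
                        (cong (x *_) (fallingValue-timesT (geometric x) c n)))
                 (fallingValue-one c (suc n)) ⟩
  x * (+ suc n * fallingValue (geometric x) c n) + fallingℤ c (suc n)
    ∎

umbral-fallingValue : ∀ x c n → umbral x (fallingPoly c n) ≡ fallingValue (geometric x) c n
umbral-fallingValue x c n =
  trans (umbralFrom-cong fubini≡transform 0 (fallingPoly c n)) (umbral-fallingPoly (geometric x) c n)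
  where
  fubini≡transform : ∀ i → fubini x i ≡ stirlingTransform (geometric x) i
  fubini≡transform i = sumTo-cong i λ k _ →
    trans (cong (_* x ^ k) (ℤP.pos-* (stirling2 i k) (factorial k)))
          (ℤP.*-assoc (+ stirling2 i k) (+ factorial k) (x ^ k))

-- Binomial coefficients and the two falling factorials

factorial≡! : ∀ n → factorial n ≡ n !
factorial≡! zero    = refl
factorial≡! (suc n) = cong (suc n ℕ.*_) (factorial≡! n)

C*factorials : ∀ {n k} → k ≤ n → (n C k) ℕ.* (k ! ℕ.* (n ℕ.∸ k) !) ≡ n !
C*factorials {n} {k} k≤n =
  trans (cong (ℕ._* (k ! ℕ.* (n ℕ.∸ k) !)) (nCk≡n!/k![n-k]! k≤n))
        (m/n*n≡m {{ℕP._!*_!≢0 k (n ℕ.∸ k)}} (k![n∸k]!∣n! k≤n))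

-- The rising factorial (r+1)(r+2)⋯(r+n), written as n! C(n+r, r).
rising : ℕ → ℕ → ℕ
rising n r = factorial n ℕ.* ((n ℕ.+ r) C r)

rising-zero : ∀ r → rising 0 r ≡ 1
rising-zero r = trans (ℕP.+-identityʳ (r C r)) (nCn≡1 r)

rising*! : ∀ n r → rising n r ℕ.* r ! ≡ (n ℕ.+ r) !
rising*! n r = begin
  factorial n ℕ.* ((n ℕ.+ r) C r) ℕ.* r !
    ≡⟨ cong (λ f → f ℕ.* ((n ℕ.+ r) C r) ℕ.* r !) (factorial≡! n) ⟩
  n ! ℕ.* ((n ℕ.+ r) C r) ℕ.* r !
    ≡⟨ rearrange (n !) (((n ℕ.+ r) C r)) (r !) ⟩
  ((n ℕ.+ r) C r) ℕ.* (r ! ℕ.* n !)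
    ≡⟨ cong (λ m → ((n ℕ.+ r) C r) ℕ.* (r ! ℕ.* m !)) (ℕP.m+n∸n≡m n r) ⟨
  ((n ℕ.+ r) C r) ℕ.* (r ! ℕ.* (n ℕ.+ r ℕ.∸ r) !)
    ≡⟨ C*factorials (ℕP.m≤n+m r n) ⟩
  (n ℕ.+ r) !
    ∎
  where
  rearrange : ∀ a b c → a ℕ.* b ℕ.* c ≡ b ℕ.* (c ℕ.* a)
  rearrange = ℕSolver.solve-∀

-- Equalities of rising factorials are checked after multiplying by r! ≠ 0.
cancel-! : ∀ {a b} r → a ℕ.* r ! ≡ b ℕ.* r ! → a ≡ b
cancel-! {a} {b} r = ℕP.*-cancelʳ-≡ a b (r !) {{ℕP._!≢0 r}}

rising-suc : ∀ n r → rising (suc n) r ≡ suc (n ℕ.+ r) ℕ.* rising n r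
rising-suc n r = cancel-! r (begin
  rising (suc n) r ℕ.* r !               ≡⟨ rising*! (suc n) r ⟩
  suc (n ℕ.+ r) ℕ.* (n ℕ.+ r) !           ≡⟨ cong (suc (n ℕ.+ r) ℕ.*_) (rising*! n r) ⟨
  suc (n ℕ.+ r) ℕ.* (rising n r ℕ.* r !)  ≡⟨ ℕP.*-assoc (suc (n ℕ.+ r)) (rising n r) (r !) ⟨
  suc (n ℕ.+ r) ℕ.* rising n r ℕ.* r !    ∎)

rising-sucʳ : ∀ n r → suc r ℕ.* rising n (suc r) ≡ rising (suc n) r
rising-sucʳ n r = cancel-! r (begin
  suc r ℕ.* rising n (suc r) ℕ.* r !   ≡⟨ rearrange (suc r) (rising n (suc r)) (r !) ⟩
  rising n (suc r) ℕ.* suc r !         ≡⟨ rising*! n (suc r) ⟩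
  (n ℕ.+ suc r) !                      ≡⟨ cong _! (ℕP.+-suc n r) ⟩
  (suc n ℕ.+ r) !                      ≡⟨ rising*! (suc n) r ⟨
  rising (suc n) r ℕ.* r !             ∎)
  where
  rearrange : ∀ a b c → a ℕ.* b ℕ.* c ≡ b ℕ.* (a ℕ.* c)
  rearrange = ℕSolver.solve-∀

fallingℤ-negative : ∀ r n → fallingℤ (- (+ r) - + 1) n ≡ (- + 1) ^ n * + rising n r
fallingℤ-negative r zero    = cong (λ m → + 1 * + m) (sym (rising-zero r))
fallingℤ-negative r (suc n) = begin
  (- (+ r) - + 1 - + n) * fallingℤ (- (+ r) - + 1) n
    ≡⟨ cong ((- (+ r) - + 1 - + n) *_) (fallingℤ-negative r n) ⟩
  (- (+ r) - + 1 - + n) * ((- + 1) ^ n * + rising n r)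
    ≡⟨ sign-out (+ r) (+ n) ((- + 1) ^ n) (+ rising n r) ⟩
  (- + 1) ^ suc n * (+ suc (n ℕ.+ r) * + rising n r)
    ≡⟨ cong ((- + 1) ^ suc n *_) (ℤP.pos-* (suc (n ℕ.+ r)) (rising n r)) ⟨
  (- + 1) ^ suc n * + (suc (n ℕ.+ r) ℕ.* rising n r)
    ≡⟨ cong (λ m → (- + 1) ^ suc n * + m) (rising-suc n r) ⟨
  (- + 1) ^ suc n * + rising (suc n) r
    ∎
  where
  sign-out : ∀ r n s b → (- r - + 1 - n) * (s * b) ≡ (- + 1 * s) * ((+ 1 + (n + r)) * b)
  sign-out = solve-∀

fallingℤ-diagonal : ∀ n r → fallingℤ (+ (n ℕ.+ r)) n ≡ + rising n r
fallingℤ-diagonal zero    r = cong +_ (sym (rising-zero r))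
fallingℤ-diagonal (suc n) r = begin
  (+ suc (n ℕ.+ r) - + n) * fallingℤ (+ suc (n ℕ.+ r)) n
    ≡⟨ cong₂ _*_ (top-factor (+ n) (+ r)) (cong (λ m → fallingℤ (+ m) n) (sym (ℕP.+-suc n r))) ⟩
  + suc r * fallingℤ (+ (n ℕ.+ suc r)) n
    ≡⟨ cong (+ suc r *_) (fallingℤ-diagonal n (suc r)) ⟩
  + suc r * + rising n (suc r)
    ≡⟨ ℤP.pos-* (suc r) (rising n (suc r)) ⟨
  + (suc r ℕ.* rising n (suc r))
    ≡⟨ cong +_ (rising-sucʳ n r) ⟩
  + rising (suc n) r
    ∎
  where
  top-factor : ∀ n r → (+ 1 + (n + r)) - n ≡ + 1 + r
  top-factor = solve-∀

Pfun-suc : ∀ n x r → Pfun (suc n) x r ≡ x * Pfun n x r + (- + 1) ^ suc n * + ((suc n ℕ.+ r) C r)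
Pfun-suc n x r = cong₂ _+_ lower-terms top-term
  where
  sign : ℕ → ℤ
  sign j = (- + 1) ^ j * + ((j ℕ.+ r) C r)

  pull-x : ∀ s x y → s * (x * y) ≡ x * (s * y)
  pull-x = solve-∀

  lower-terms : sumTo n (λ j → sign j * x ^ (suc n ℕ.∸ j)) ≡ x * Pfun n x r
  lower-terms = begin
    sumTo n (λ j → sign j * x ^ (suc n ℕ.∸ j))
      ≡⟨ sumTo-cong n (λ j j≤n → trans (cong (λ e → sign j * x ^ e) (ℕP.+-∸-assoc 1 j≤n))
                                       (pull-x (sign j) x (x ^ (n ℕ.∸ j)))) ⟩
    sumTo n (λ j → x * (sign j * x ^ (n ℕ.∸ j)))
      ≡⟨ sumTo-*ˡ n x (λ j → sign j * x ^ (n ℕ.∸ j)) ⟨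
    x * Pfun n x r
      ∎

  top-term : sign (suc n) * x ^ (suc n ℕ.∸ suc n) ≡ sign (suc n)
  top-term = trans (cong (λ e → sign (suc n) * x ^ e) (ℕP.n∸n≡0 n)) (ℤP.*-identityʳ (sign (suc n)))

Tfun-suc : ∀ n x r → Tfun (suc n) x r ≡ x * Tfun n x (suc r) + + ((suc n ℕ.+ r) C r)
Tfun-suc n x r = begin
  Tfun (suc n) x r
    ≡⟨ sumTo-suc n term ⟩
  term 0 + sumTo n (term ∘ suc)
    ≡⟨ cong₂ _+_ (ℤP.*-identityʳ (+ ((suc n ℕ.+ r) C r))) higher-terms ⟩
  + ((suc n ℕ.+ r) C r) + x * Tfun n x (suc r)
    ≡⟨ ℤP.+-comm (+ ((suc n ℕ.+ r) C r)) (x * Tfun n x (suc r)) ⟩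
  x * Tfun n x (suc r) + + ((suc n ℕ.+ r) C r)
    ∎
  where
  term : ℕ → ℤ
  term j = + ((suc n ℕ.+ r) C (j ℕ.+ r)) * x ^ j

  pull-x : ∀ c x y → c * (x * y) ≡ x * (c * y)
  pull-x = solve-∀

  higher-terms : sumTo n (term ∘ suc) ≡ x * Tfun n x (suc r)
  higher-terms = begin
    sumTo n (term ∘ suc)
      ≡⟨ sumTo-cong n (λ j _ →
           trans (cong₂ (λ a b → + (a C b) * x ^ suc j) (sym (ℕP.+-suc n r)) (sym (ℕP.+-suc j r)))
                 (pull-x (+ ((n ℕ.+ suc r) C (j ℕ.+ suc r))) x (x ^ j))) ⟩
    sumTo n (λ j → x * (+ ((n ℕ.+ suc r) C (j ℕ.+ suc r)) * x ^ j))
      ≡⟨ sumTo-*ˡ n x (λ j → + ((n ℕ.+ suc r) C (j ℕ.+ suc r)) * x ^ j) ⟨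
    x * Tfun n x (suc r)
      ∎

-- Solving a_{n+1} = x (n+1) aₙ + (n+1)! β from aₙ = n! p.
factorial-step : ∀ n x p β →
  x * (+ suc n * (+ factorial n * p)) + + factorial (suc n) * β ≡ + factorial (suc n) * (x * p + β)
factorial-step n x p β = begin
  x * (+ suc n * (+ factorial n * p)) + + factorial (suc n) * β
    ≡⟨ cong (λ f → x * (+ suc n * (+ factorial n * p)) + f * β) n!-split ⟩
  x * (+ suc n * (+ factorial n * p)) + (+ suc n * + factorial n) * β
    ≡⟨ regroup x (+ suc n) (+ factorial n) p β ⟩
  (+ suc n * + factorial n) * (x * p + β)
    ≡⟨ cong (_* (x * p + β)) n!-split ⟨
  + factorial (suc n) * (x * p + β)
    ∎
  where
  n!-split : + factorial (suc n) ≡ + suc n * + factorial n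
  n!-split = ℤP.pos-* (suc n) (factorial n)

  regroup : ∀ x m f p β → x * (m * (f * p)) + (m * f) * β ≡ (m * f) * (x * p + β)
  regroup = solve-∀

fallingValue-P : ∀ x r n → fallingValue (geometric x) (- (+ r) - + 1) n ≡ + factorial n * Pfun n x r
fallingValue-P x r zero    = cong (λ m → + 1 * (+ 1 * + m * + 1)) (sym (nCn≡1 r))
fallingValue-P x r (suc n) = begin
  fallingValue (geometric x) c (suc n)
    ≡⟨ fallingValue-geometric x c n ⟩
  x * (+ suc n * fallingValue (geometric x) c n) + fallingℤ c (suc n)
    ≡⟨ cong₂ (λ a b → x * (+ suc n * a) + b) (fallingValue-P x r n) (fallingℤ-negative r (suc n)) ⟩
  x * (+ suc n * (+ factorial n * Pfun n x r)) + σ * + (factorial (suc n) ℕ.* binomial)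
    ≡⟨ cong (λ t → x * (+ suc n * (+ factorial n * Pfun n x r)) + t) sign-inside ⟩
  x * (+ suc n * (+ factorial n * Pfun n x r)) + + factorial (suc n) * (σ * + binomial)
    ≡⟨ factorial-step n x (Pfun n x r) (σ * + binomial) ⟩
  + factorial (suc n) * (x * Pfun n x r + σ * + binomial)
    ≡⟨ cong (+ factorial (suc n) *_) (Pfun-suc n x r) ⟨
  + factorial (suc n) * Pfun (suc n) x r
    ∎
  where
  c = - (+ r) - + 1
  σ = (- + 1) ^ suc n
  binomial = (suc n ℕ.+ r) C r

  swap : ∀ a b c → a * (b * c) ≡ b * (a * c)
  swap = solve-∀

  sign-inside : σ * + (factorial (suc n) ℕ.* binomial) ≡ + factorial (suc n) * (σ * + binomial)
  sign-inside = trans (cong (σ *_) (ℤP.pos-* (factorial (suc n)) binomial))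
                      (swap σ (+ factorial (suc n)) (+ binomial))

-- The second identity, in terms of fallingValue; r varies in the induction.
fallingValue-T : ∀ x n r → fallingValue (geometric x) (+ n + + r) n ≡ + factorial n * Tfun n x r
fallingValue-T x zero    r = cong (λ m → + 1 * (+ m * + 1)) (sym (nCn≡1 r))
fallingValue-T x (suc n) r = begin
  fallingValue (geometric x) (+ (suc n ℕ.+ r)) (suc n)
    ≡⟨ fallingValue-geometric x (+ (suc n ℕ.+ r)) n ⟩
  x * (+ suc n * fallingValue (geometric x) (+ (suc n ℕ.+ r)) n) + fallingℤ (+ (suc n ℕ.+ r)) (suc n)
    ≡⟨ cong₂ (λ a b → x * (+ suc n * a) + b) shifted (fallingℤ-diagonal (suc n) r) ⟩
  x * (+ suc n * (+ factorial n * Tfun n x (suc r))) + + (factorial (suc n) ℕ.* binomial)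
    ≡⟨ cong (λ t → x * (+ suc n * (+ factorial n * Tfun n x (suc r))) + t)
            (ℤP.pos-* (factorial (suc n)) binomial) ⟩
  x * (+ suc n * (+ factorial n * Tfun n x (suc r))) + + factorial (suc n) * + binomial
    ≡⟨ factorial-step n x (Tfun n x (suc r)) (+ binomial) ⟩
  + factorial (suc n) * (x * Tfun n x (suc r) + + binomial)
    ≡⟨ cong (+ factorial (suc n) *_) (Tfun-suc n x r) ⟨
  + factorial (suc n) * Tfun (suc n) x r
    ∎
  where
  binomial = (suc n ℕ.+ r) C r

  shifted : fallingValue (geometric x) (+ (suc n ℕ.+ r)) n ≡ + factorial n * Tfun n x (suc r)
  shifted = trans (cong (λ m → fallingValue (geometric x) (+ m) n) (sym (ℕP.+-suc n r)))
                  (fallingValue-T x n (suc r))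

proposition3 : (n r : ℕ) (x : ℤ) →
    (umbral x (fallingPoly (- (+ r) - + 1) n) ≡ + (factorial n) * Pfun n x r)
    × (umbral x (fallingPoly (+ n + + r) n) ≡ + (factorial n) * Tfun n x r)
proposition3 n r x =
  trans (umbral-fallingValue x (- (+ r) - + 1) n) (fallingValue-P x r n) ,
  trans (umbral-fallingValue x (+ n + + r) n) (fallingValue-T x n r)
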